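{- Let $t$ be a term and $x\in FV(t)$. Then every free occurrence $x_0$ of $x$ in $t$ has depth at most $1$ in $t$. Moreover all free occurrences of $x$ in $t$ have the same depth $d_t(x)$, and $d_t(x)=1$ if and only if $x\in TV(t)$.
   Context: Pseudo-terms are given by the grammar $t ::= x \mid \lambda x.t \mid (t\,t') \mid\, !t \mid \mathrm{let}\ t\ \mathrm{be}\ !x\ \mathrm{in}\ t'$. In $\mathrm{let}\ u\ \mathrm{be}\ !x\ \mathrm{in}\ t_1$ the variable $x$ is bound in $t_1$: $FV(\mathrm{let}\ u\ \mathrm{be}\ !x\ \mathrm{in}\ t_1)=FV(u)\cup(FV(t_1)\setminus\{x\})$; $\lambda$ binds as usual. $FV(t)$ is the set of free variables of $t$, and $no(x,t)$ is the number of free occurrences of $x$ in $t$. Terms and their sets of temporary variables $TV(t)\subseteq FV(t)$ are defined simultaneously as the smallest set of pseudo-terms such that: (i) a variable $x$ is a term, $TV(x)=\emptyset$; (ii) $\lambda x.t$ is a term iff $t$ is a term, $x\notin TV(t)$ and $no(x,t)\le 1$, and then $TV(\lambda x.t)=TV(t)$; (iii) $(t_1\,t_2)$ is a term iff $t_1,t_2$ are terms, $TV(t_1)\cap FV(t_2)=\emptyset$ and $FV(t_1)\cap TV(t_2)=\emptyset$, and then $TV(t_1\,t_2)=TV(t_1)\cup TV(t_2)$; (iv) $!t$ is a term iff $t$ is a term, $TV(t)=\emptyset$ and $no(x,t)=1$ for all $x\in FV(t)$, and then $TV(!t)=FV(t)$; (v) $\mathrm{let}\ t_1\ \mathrm{be}\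 !x\ \mathrm{in}\ t_2$ is a term iff $t_1,t_2$ are terms, $TV(t_1)\cap FV(t_2)=\emptyset$ and $FV(t_1)\cap TV(t_2)=\emptyset$, and then its $TV$ is $TV(t_1)\cup(TV(t_2)\setminus\{x\})$. Depth: for an occurrence $u$ of a subterm of a term $t$, its depth in $t$ is the number of subterm occurrences $v$ of $t$ of the form $!v'$ such that $u$ is a subterm of $v$. -}

module Defs where

open import Data.Nat using (ℕ; zero; suc; _+_; _≤_; _≟_)
open import Data.Empty using (⊥)
open import Data.Sum using (_⊎_)
open import Data.Product using (_×_)
open import Relation.Nullary using (¬_)
import Relation.Nullary as N
open import Relation.Binary.PropositionalEquality using (_≡_; _≢_)

Var : Set
Var = ℕ

data PTerm : Set where
  var  : Var → PTerm
  lam  : Var → PTerm → PTerm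
  app  : PTerm → PTerm → PTerm
  bang : PTerm → PTerm
  letb : PTerm → Var → PTerm → PTerm   -- letb u x t  =  let u be !x in t

data FV (x : Var) : PTerm → Set where
  fv-var  : FV x (var x)
  fv-lam  : ∀ {y t} → x ≢ y → FV x t → FV x (lam y t)
  fv-appl : ∀ {t u} → FV x t → FV x (app t u)
  fv-appr : ∀ {t u} → FV x u → FV x (app t u)
  fv-bang : ∀ {t} → FV x t → FV x (bang t)
  fv-let1 : ∀ {u y t} → FV x u → FV x (letb u y t)
  fv-let2 : ∀ {u y t} → x ≢ y → FV x t → FV x (letb u y t)

no : Var → PTerm → ℕ
no x (var y) with x ≟ y
... | N.yes _ = 1
... | N.no  _ = 0
no x (lam y t) with x ≟ y
... | N.yes _ = 0
... | N.no  _ = no x t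
no x (app t u) = no x t + no x u
no x (bang t) = no x t
no x (letb u y t) with x ≟ y
... | N.yes _ = no x u
... | N.no  _ = no x u + no x t

TV : PTerm → Var → Set
TV (var y) z = ⊥
TV (lam y t) z = TV t z
TV (app t u) z = TV t z ⊎ TV u z
TV (bang t) z = FV z t
TV (letb u y t) z = TV u z ⊎ (TV t z × z ≢ y)

data IsTerm : PTerm → Set where
  t-var  : ∀ {x} → IsTerm (var x)
  t-lam  : ∀ {x t} → IsTerm t → ¬ TV t x → no x t ≤ 1 → IsTerm (lam x t)
  t-app  : ∀ {t₁ t₂} → IsTerm t₁ → IsTerm t₂
         → (∀ z → TV t₁ z → ¬ FV z t₂)
         → (∀ z → FV z t₁ → ¬ TV t₂ z)
         → IsTerm (app t₁ t₂)
  t-bang : ∀ {t} → IsTerm t → (∀ z → ¬ TV t z)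
         → (∀ z → FV z t → no z t ≡ 1)
         → IsTerm (bang t)
  t-let  : ∀ {t₁ x t₂} → IsTerm t₁ → IsTerm t₂
         → (∀ z → TV t₁ z → ¬ FV z t₂)
         → (∀ z → FV z t₁ → ¬ TV t₂ z)
         → IsTerm (letb t₁ x t₂)

-- FreeOcc x t d : a free occurrence of x in t (the proof object is the
-- path to that occurrence) whose depth in t is d (number of enclosing !).
data FreeOcc (x : Var) : PTerm → ℕ → Set where
  o-var  : FreeOcc x (var x) 0
  o-lam  : ∀ {y t d} → x ≢ y → FreeOcc x t d → FreeOcc x (lam y t) d
  o-appl : ∀ {t u d} → FreeOcc x t d → FreeOcc x (app t u) d
  o-appr : ∀ {t u d} → FreeOcc x u d → FreeOcc x (app t u) d
  o-bang : ∀ {t d} → FreeOcc x t d → FreeOcc x (bang t) (suc d)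
  o-let1 : ∀ {u y t d} → FreeOcc x u d → FreeOcc x (letb u y t) d
  o-let2 : ∀ {u y t d} → x ≢ y → FreeOcc x t d → FreeOcc x (letb u y t) d

{-# OPTIONS --safe #-}
module Submission where

open import Defs
open import Data.Nat using (ℕ; _≤_; suc; z≤n; s≤s)
open import Data.Product using (Σ; _×_; _,_; proj₁; map₂)
open import Data.Sum using (_⊎_; inj₁; inj₂; [_,_])
import Data.Sum as Sum
import Data.Product as Product
open import Data.Empty using (⊥-elim)
open import Function using (id; _∘_; flip)
open import Relation.Nullary using (¬_)
open import Relation.Binary.PropositionalEquality using (_≡_; refl; sym; trans; cong)

-- An occurrence can only reach depth 1 by passing a !, whose free variables are
-- exactly its temporary variables; it can never pass a second !, since !t demands
-- TV(t) = ∅. The disjointness side conditions of application and let guarantee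
-- that x is temporary in the whole term iff it is temporary in the subterm
-- containing the occurrence. So every depth of x is the indicator of x ∈ TV(t).

FreeOcc⇒FV : ∀ {x t d} → FreeOcc x t d → FV x t
FreeOcc⇒FV o-var        = fv-var
FreeOcc⇒FV (o-lam p o)  = fv-lam p (FreeOcc⇒FV o)
FreeOcc⇒FV (o-appl o)   = fv-appl (FreeOcc⇒FV o)
FreeOcc⇒FV (o-appr o)   = fv-appr (FreeOcc⇒FV o)
FreeOcc⇒FV (o-bang o)   = fv-bang (FreeOcc⇒FV o)
FreeOcc⇒FV (o-let1 o)   = fv-let1 (FreeOcc⇒FV o)
FreeOcc⇒FV (o-let2 p o) = fv-let2 p (FreeOcc⇒FV o)

FV⇒FreeOcc : ∀ {x t} → FV x t → Σ ℕ (FreeOcc x t)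
FV⇒FreeOcc fv-var        = 0 , o-var
FV⇒FreeOcc (fv-lam p f)  = map₂ (o-lam p) (FV⇒FreeOcc f)
FV⇒FreeOcc (fv-appl f)   = map₂ o-appl (FV⇒FreeOcc f)
FV⇒FreeOcc (fv-appr f)   = map₂ o-appr (FV⇒FreeOcc f)
FV⇒FreeOcc (fv-bang f)   = Product.map suc o-bang (FV⇒FreeOcc f)
FV⇒FreeOcc (fv-let1 f)   = map₂ o-let1 (FV⇒FreeOcc f)
FV⇒FreeOcc (fv-let2 p f) = map₂ (o-let2 p) (FV⇒FreeOcc f)

Indicator : Set → ℕ → Set
Indicator P d = (d ≡ 0 × ¬ P) ⊎ (d ≡ 1 × P)

Indicator-resp : ∀ {P Q d} → (P → Q) → (Q → P) → Indicator P d → Indicator Q d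
Indicator-resp to from = Sum.map (map₂ (_∘ from)) (map₂ to)

Indicator⇒≤1 : ∀ {P d} → Indicator P d → d ≤ 1
Indicator⇒≤1 (inj₁ (refl , _)) = z≤n
Indicator⇒≤1 (inj₂ (refl , _)) = s≤s z≤n

Indicator-unique : ∀ {P d d′} → Indicator P d → Indicator P d′ → d ≡ d′
Indicator-unique (inj₁ (d≡0 , _)) (inj₁ (d′≡0 , _)) = trans d≡0 (sym d′≡0)
Indicator-unique (inj₂ (d≡1 , _)) (inj₂ (d′≡1 , _)) = trans d≡1 (sym d′≡1)
Indicator-unique (inj₁ (_ , ¬p))  (inj₂ (_ , p))    = ⊥-elim (¬p p)
Indicator-unique (inj₂ (_ , p))   (inj₁ (_ , ¬p))   = ⊥-elim (¬p p)

Indicator⇒≡1⇔ : ∀ {P d} → Indicator P d → (d ≡ 1 → P) × (P → d ≡ 1)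
Indicator⇒≡1⇔ (inj₁ (refl , ¬p)) = (λ ()) , ⊥-elim ∘ ¬p
Indicator⇒≡1⇔ (inj₂ (d≡1 , p))   = (λ _ → p) , (λ _ → d≡1)

freeOcc-depth-indicator : ∀ {x t d} → IsTerm t → FreeOcc x t d → Indicator (TV t x) d
freeOcc-depth-indicator t-var o-var = inj₁ (refl , λ ())
freeOcc-depth-indicator (t-lam i _ _) (o-lam _ o) = freeOcc-depth-indicator i o
freeOcc-depth-indicator {x} (t-app i₁ _ _ c₂) (o-appl o) =
  Indicator-resp inj₁ [ id , ⊥-elim ∘ c₂ x (FreeOcc⇒FV o) ]
    (freeOcc-depth-indicator i₁ o)
freeOcc-depth-indicator {x} (t-app _ i₂ c₁ _) (o-appr o) =
  Indicator-resp inj₂ [ ⊥-elim ∘ flip (c₁ x) (FreeOcc⇒FV o) , id ]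
    (freeOcc-depth-indicator i₂ o)
freeOcc-depth-indicator {x} (t-bang i ¬tv _) (o-bang o) with freeOcc-depth-indicator i o
... | inj₁ (d≡0 , _) = inj₂ (cong suc d≡0 , FreeOcc⇒FV o)
... | inj₂ (_ , tv)  = ⊥-elim (¬tv x tv)
freeOcc-depth-indicator {x} (t-let i₁ _ _ c₂) (o-let1 o) =
  Indicator-resp inj₁ [ id , ⊥-elim ∘ c₂ x (FreeOcc⇒FV o) ∘ proj₁ ]
    (freeOcc-depth-indicator i₁ o)
freeOcc-depth-indicator {x} (t-let _ i₂ c₁ _) (o-let2 x≢y o) =
  Indicator-resp (inj₂ ∘ (_, x≢y)) [ ⊥-elim ∘ flip (c₁ x) (FreeOcc⇒FV o) , proj₁ ]
    (freeOcc-depth-indicator i₂ o)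

mainTheorem8 : (t : PTerm) → IsTerm t → (x : Var) → FV x t →
    ((d : ℕ) → FreeOcc x t d → d ≤ 1) ×
    Σ ℕ (λ dt → ((d : ℕ) → FreeOcc x t d → d ≡ dt) × ((dt ≡ 1 → TV t x) × (TV t x → dt ≡ 1)))
mainTheorem8 t it x f with FV⇒FreeOcc f
... | dt , o =
  (λ _ o′ → Indicator⇒≤1 (depth o′)) ,
  dt , (λ _ o′ → Indicator-unique (depth o′) (depth o)) , Indicator⇒≡1⇔ (depth o)
  where
  depth : ∀ {d} → FreeOcc x t d → Indicator (TV t x) d
  depth = freeOcc-depth-indicator it
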